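{- For $i=1,2$ let $U_i$ be an $(h,k_i)_q$-evasive subspace of $V_i=V(r_i,q^n)$. Then $U=U_1\oplus U_2$ is an $(h,k_1+k_2-h)_q$-evasive subspace of $V=V_1\oplus V_2$.
   Context: $V(m,q^n)$ denotes an $m$-dimensional vector space over $\mathbb{F}_{q^n}$, viewed also as an $mn$-dimensional vector space over $\mathbb{F}_q$. For positive integers $h,k$, an $\mathbb{F}_q$-subspace $U$ of an $\mathbb{F}_{q^n}$-vector space $V$ is called $(h,k)_q$-evasive if $\langle U\rangle_{\mathbb{F}_{q^n}}$ has $\mathbb{F}_{q^n}$-dimension at least $h$ and every $h$-dimensional $\mathbb{F}_{q^n}$-subspace of $V$ meets $U$ in an $\mathbb{F}_q$-subspace of $\mathbb{F}_q$-dimension at most $k$. -}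

module Defs where

open import Level using (0ℓ)
open import Data.Nat using (ℕ; zero; suc; _≤_) renaming (_+_ to _+ℕ_)
open import Data.Fin using (Fin; zero; suc)
open import Data.Product using (_×_; ∃; _,_)
open import Data.Vec.Functional using (_++_)
open import Relation.Nullary using (¬_)
open import Data.Unit using (⊤)
open import Relation.Binary.PropositionalEquality using (_≡_)
open import Algebra.Bundles using (CommutativeRing)

module Sums (R : CommutativeRing 0ℓ 0ℓ) where
  open CommutativeRing R using (Carrier; _+_; _*_; 0#)
  sumᶠ : (d : ℕ) → (Fin d → Carrier) → Carrier
  sumᶠ zero    f = 0#
  sumᶠ (suc d) f = f zero + sumᶠ d (λ i → f (suc i))

-- A field K (a commutative ring with 1 ≠ 0 in which nonzero elements are
-- invertible) together with a subfield F of size q (F = 𝔽_q) such that K has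
-- dimension n over F (so K = 𝔽_{q^n}).
record FiniteFieldExt (q n : ℕ) : Set₁ where
  field
    R : CommutativeRing 0ℓ 0ℓ
  open CommutativeRing R public using (Carrier; _≈_; _+_; _*_; -_; 0#; 1#)
  open Sums R public
  field
    1≉0     : ¬ (1# ≈ 0#)
    inv     : ∀ x → ¬ (x ≈ 0#) → ∃ λ y → x * y ≈ 1#
    F       : Carrier → Set
    F-resp  : ∀ {x y} → x ≈ y → F x → F y
    F-0     : F 0#
    F-1     : F 1#
    F-+     : ∀ x y → F x → F y → F (x + y)
    F-neg   : ∀ x → F x → F (- x)
    F-*     : ∀ x y → F x → F y → F (x * y)
    F-inv   : ∀ x → F x → ¬ (x ≈ 0#) → ∃ λ y → F y × (x * y ≈ 1#)
    enum      : Fin q → Carrier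
    enum-F    : ∀ i → F (enum i)
    enum-inj  : ∀ i j → enum i ≈ enum j → i ≡ j
    enum-surj : ∀ x → F x → ∃ λ i → x ≈ enum i
    basis       : Fin n → Carrier
    basis-indep : ∀ (c : Fin n → Carrier) → (∀ i → F (c i)) →
                  sumᶠ n (λ i → c i * basis i) ≈ 0# → ∀ i → c i ≈ 0#
    basis-span  : ∀ x → ∃ λ (c : Fin n → Carrier) →
                  (∀ i → F (c i)) × (x ≈ sumᶠ n (λ i → c i * basis i))

module _ {q n : ℕ} (E : FiniteFieldExt q n) where
  open FiniteFieldExt E

  Vect : ℕ → Set
  Vect r = Fin r → Carrier

  _≋_ : ∀ {r} → Vect r → Vect r → Set
  u ≋ v = ∀ j → u j ≈ v j

  0ᵛ : ∀ {r} → Vect r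
  0ᵛ _ = 0#

  _+ᵛ_ : ∀ {r} → Vect r → Vect r → Vect r
  (u +ᵛ v) j = u j + v j

  _•_ : ∀ {r} → Carrier → Vect r → Vect r
  (a • u) j = a * u j

  lincomb : ∀ {r} (d : ℕ) → (Fin d → Carrier) → (Fin d → Vect r) → Vect r
  lincomb d c b j = sumᶠ d (λ i → c i * b i j)

  -- Scalar domains: S = F gives 𝔽_q-linear notions, S = All gives 𝔽_{q^n}-linear ones.
  All : Carrier → Set
  All _ = ⊤

  Subspace : (S : Carrier → Set) → ∀ {r} → (Vect r → Set) → Set
  Subspace S {r} U =
    (∀ {u v} → u ≋ v → U u → U v) ×
    U 0ᵛ ×
    (∀ u v → U u → U v → U (u +ᵛ v)) ×
    (∀ a u → S a → U u → U (a • u))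

  LinIndep : (S : Carrier → Set) → ∀ {r} (d : ℕ) → (Fin d → Vect r) → Set
  LinIndep S d b = ∀ (c : Fin d → Carrier) → (∀ i → S (c i)) →
                   lincomb d c b ≋ 0ᵛ → ∀ i → c i ≈ 0#

  HasDim : (S : Carrier → Set) → ∀ {r} → (Vect r → Set) → ℕ → Set
  HasDim S X d = ∃ λ b → (∀ i → X (b i)) × LinIndep S d b ×
                 (∀ x → X x → ∃ λ c → (∀ i → S (c i)) × (x ≋ lincomb d c b))

  DimAtLeast : (S : Carrier → Set) → ∀ {r} → (Vect r → Set) → ℕ → Set
  DimAtLeast S X h = ∃ λ (b : Fin h → _) → (∀ i → X (b i)) × LinIndep S h b

  DimAtMost : (S : Carrier → Set) → ∀ {r} → (Vect r → Set) → ℕ → Set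
  DimAtMost S {r} X k = ∀ (d : ℕ) (b : Fin d → Vect r) → (∀ i → X (b i)) →
                        LinIndep S d b → d ≤ k

  Span : ∀ {r} → (Vect r → Set) → Vect r → Set
  Span {r} U v = ∃ λ d → ∃ λ (c : Fin d → Carrier) → ∃ λ (u : Fin d → Vect r) →
                 (∀ i → U (u i)) × (v ≋ lincomb d c u)

  Evasive : (h k r : ℕ) → (Vect r → Set) → Set₁
  Evasive h k r U =
    Subspace F U ×
    DimAtLeast All (Span U) h ×
    (∀ (W : Vect r → Set) → Subspace All W → HasDim All W h →
       DimAtMost F (λ v → W v × U v) k)

  -- U₁ ⊕ U₂ inside V(r₁,q^n) ⊕ V(r₂,q^n) = V(r₁+r₂,q^n) (coordinates concatenated)
  DirectSum : ∀ {r₁ r₂} → (Vect r₁ → Set) → (Vect r₂ → Set) → Vect (r₁ +ℕ r₂) → Set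
  DirectSum {r₁} {r₂} U₁ U₂ v =
    ∃ λ u₁ → ∃ λ u₂ → U₁ u₁ × U₂ u₂ × (v ≋ (u₁ ++ u₂))

module Submission where

-- Only the intersection bound needs work.  Let W ⊆ V₁ ⊕ V₂ have an 𝔽_{q^n}-basis
-- w of length h and let b be d 𝔽_q-independent vectors of W ∩ (U₁ ⊕ U₂).
-- Decomposing a family along the projection π₂ (section 4) gives
--   a + t ≤ h    where t = dim π₂⟨w⟩,  a = dim π₁(⟨w⟩ ∩ V₁)   (over 𝔽_{q^n}),
--   d ≤ a' + t'  where t' = dim π₂⟨b⟩, a' = dim π₁(⟨b⟩ ∩ V₁)  (over 𝔽_q).
-- The counting lemma (section 5): if U is (h,k)_q-evasive, P is spanned by s ≤ h
-- independent vectors and U ∩ P contains e 𝔽_q-independent vectors, then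
-- e + h ≤ k + s, because P can be completed by h − s vectors of U to an
-- h-dimensional subspace meeting U in e + h − s independent vectors.  Applied to
-- π₁(⟨b⟩ ∩ V₁) ⊆ U₁ ∩ π₁(⟨w⟩ ∩ V₁) and π₂⟨b⟩ ⊆ U₂ ∩ π₂⟨w⟩ it gives a' + h ≤ k₁ + a
-- and t' + h ≤ k₂ + t; adding up, d ≤ k₁ + k₂ − h (section 6).
--
-- Agda is constructive, so the linear algebra (section 3: Steinitz exchange,
-- bases of finite families, extension of independent families) is developed over
-- any exhaustively searchable subfield of scalars.  𝔽_q and 𝔽_{q^n} are finite,
-- so equality is decidable and both are searchable (section 2).

open import Defs
open import Level using (0ℓ)
import Data.Nat as ℕ
open ℕ using (ℕ; zero; suc)
import Data.Nat.Properties as ℕₚ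
open import Data.Fin using (Fin; zero; suc; punchIn; splitAt; _↑ˡ_; _↑ʳ_)
import Data.Fin.Properties as Finₚ
open import Data.Product using (_×_; ∃; _,_; proj₁; proj₂; Σ)
open import Data.Sum using (inj₁; inj₂)
open import Data.Unit using (tt)
open import Data.Empty using (⊥-elim)
open import Relation.Nullary using (¬_; ¬?; Dec; yes; no)
open import Relation.Binary.PropositionalEquality as ≡ using (_≡_)
open import Data.Vec.Functional using (_++_; _∷_; insertAt)
open import Data.Vec.Functional.Properties using (lookup-++ˡ; lookup-++ʳ; insertAt-lookup; insertAt-punchIn)
open import Algebra.Bundles using (CommutativeRing)

module Arithmetic where
  open import Data.Nat
  open import Data.Nat.Properties
  open import Data.Nat.Tactic.RingSolver
  open import Relation.Binary.PropositionalEquality using (_≡_; cong)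

  shift-bound : ∀ d h s k → s ≤ h → d + (h ∸ s) ≤ k → d + h ≤ k + s
  shift-bound d h s k s≤h bound = begin
    d + h              ≡⟨ cong (d +_) (m∸n+n≡m s≤h) ⟨
    d + (h ∸ s + s)    ≡⟨ +-assoc d _ s ⟨
    (d + (h ∸ s)) + s  ≤⟨ +-monoˡ-≤ s bound ⟩
    k + s              ∎
    where open ≤-Reasoning

  combine-bounds : ∀ d a' t' a t h k₁ k₂ → d ≤ a' + t' → a' + h ≤ k₁ + a →
                   t' + h ≤ k₂ + t → a + t ≤ h → d ≤ k₁ + k₂ ∸ h
  combine-bounds d a' t' a t h k₁ k₂ d≤ bound₁ bound₂ a+t≤h =
    m+n≤o⇒m≤o∸n d (+-cancelʳ-≤ h (d + h) (k₁ + k₂) chain)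
    where
    open ≤-Reasoning
    regroup₁ : ∀ x y z → (x + y + z) + z ≡ (x + z) + (y + z)
    regroup₁ = solve-∀
    regroup₂ : ∀ x y z w → (x + y) + (z + w) ≡ (x + z) + (y + w)
    regroup₂ = solve-∀
    chain : (d + h) + h ≤ (k₁ + k₂) + h
    chain = begin
      (d + h) + h          ≤⟨ +-monoˡ-≤ h (+-monoˡ-≤ h d≤) ⟩
      (a' + t' + h) + h    ≡⟨ regroup₁ a' t' h ⟩
      (a' + h) + (t' + h)  ≤⟨ +-mono-≤ bound₁ bound₂ ⟩
      (k₁ + a) + (k₂ + t)  ≡⟨ regroup₂ k₁ a k₂ t ⟩
      (k₁ + k₂) + (a + t)  ≤⟨ +-monoʳ-≤ (k₁ + k₂) a+t≤h ⟩
      (k₁ + k₂) + h        ∎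

++-all : ∀ {A : Set} (P : A → Set) {a b} (x : Fin a → A) (y : Fin b → A) →
         (∀ k → P (x k)) → (∀ k → P (y k)) → ∀ i → P ((x ++ y) i)
++-all P {a} x y px py i with splitAt a i
... | inj₁ k = px k
... | inj₂ k = py k

++-map : ∀ {A B : Set} (f : A → B) {a b} (x : Fin a → A) (y : Fin b → A) i →
         f ((x ++ y) i) ≡ ((λ k → f (x k)) ++ (λ k → f (y k))) i
++-map f {a} x y i with splitAt a i
... | inj₁ _ = ≡.refl
... | inj₂ _ = ≡.refl

++-map₂ : ∀ {A B C : Set} (f : A → B → C) {a b} (x : Fin a → A) (y : Fin b → A)
          (x' : Fin a → B) (y' : Fin b → B) i →
          f ((x ++ y) i) ((x' ++ y') i) ≡ ((λ k → f (x k) (x' k)) ++ (λ k → f (y k) (y' k))) i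
++-map₂ f {a} x y x' y' i with splitAt a i
... | inj₁ _ = ≡.refl
... | inj₂ _ = ≡.refl

++-halves : ∀ {A : Set} a b (f : Fin (a ℕ.+ b) → A) i →
            f i ≡ ((λ k → f (k ↑ˡ b)) ++ (λ k → f (a ↑ʳ k))) i
++-halves a b f i with splitAt a i in eq
... | inj₁ _ = ≡.cong f (≡.sym (Finₚ.splitAt⁻¹-↑ˡ eq))
... | inj₂ _ = ≡.cong f (≡.sym (Finₚ.splitAt⁻¹-↑ʳ eq))

++-suc : ∀ {A : Set} {a b} (f : Fin (suc a) → A) (g : Fin b → A) (i : Fin (a ℕ.+ b)) →
         (f ++ g) (suc i) ≡ ((λ k → f (suc k)) ++ g) i
++-suc {a = a} f g i with splitAt a i
... | inj₁ _ = ≡.refl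
... | inj₂ _ = ≡.refl

∷-++ : ∀ {A : Set} {a b} (w : A) (e : Fin a → A) (p : Fin b → A) i →
       (w ∷ (e ++ p)) i ≡ ((w ∷ e) ++ p) i
∷-++ w e p zero    = ≡.refl
∷-++ w e p (suc i) = ≡.sym (++-suc (w ∷ e) p i)

total : ∀ h → (Fin h → ℕ) → ℕ
total zero    ds = 0
total (suc h) ds = ds zero ℕ.+ total h (λ i → ds (suc i))

concat : ∀ {A : Set} h (ds : Fin h → ℕ) → (∀ i → Fin (ds i) → A) → Fin (total h ds) → A
concat zero    ds fs = λ ()
concat (suc h) ds fs = fs zero ++ concat h (λ i → ds (suc i)) (λ i → fs (suc i))

concat-all : ∀ {A : Set} (P : A → Set) h ds (fs : ∀ i → Fin (ds i) → A) →
             (∀ i k → P (fs i k)) → ∀ l → P (concat h ds fs l)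
concat-all P zero    ds fs Pfs ()
concat-all P (suc h) ds fs Pfs =
  ++-all P (fs zero) _ (Pfs zero) (concat-all P h (λ i → ds (suc i)) (λ i → fs (suc i)) (λ i → Pfs (suc i)))

-- Section 1.  Finite sums Σ_{i<d} in a commutative ring.
module SumProperties (R : CommutativeRing 0ℓ 0ℓ) where
  open CommutativeRing R hiding (zero)
  open import Algebra.Properties.Ring ring using (-0#≈0#; -‿+-comm)
  open import Relation.Binary.Reasoning.Setoid setoid
  open Sums R

  sum-cong : ∀ d {f g : Fin d → Carrier} → (∀ i → f i ≈ g i) → sumᶠ d f ≈ sumᶠ d g
  sum-cong zero    eq = refl
  sum-cong (suc d) eq = +-cong (eq zero) (sum-cong d (λ i → eq (suc i)))

  sum-0 : ∀ d {f : Fin d → Carrier} → (∀ i → f i ≈ 0#) → sumᶠ d f ≈ 0#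
  sum-0 zero    eq = refl
  sum-0 (suc d) eq = trans (+-cong (eq zero) (sum-0 d (λ i → eq (suc i)))) (+-identityˡ 0#)

  +-interchange : ∀ a b c d → (a + b) + (c + d) ≈ (a + c) + (b + d)
  +-interchange a b c d = begin
    (a + b) + (c + d)  ≈⟨ +-assoc a b (c + d) ⟩
    a + (b + (c + d))  ≈⟨ +-congˡ (+-assoc b c d) ⟨
    a + ((b + c) + d)  ≈⟨ +-congˡ (+-congʳ (+-comm b c)) ⟩
    a + ((c + b) + d)  ≈⟨ +-congˡ (+-assoc c b d) ⟩
    a + (c + (b + d))  ≈⟨ +-assoc a c (b + d) ⟨
    (a + c) + (b + d)  ∎

  sum-+ : ∀ d (f g : Fin d → Carrier) → sumᶠ d (λ i → f i + g i) ≈ sumᶠ d f + sumᶠ d g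
  sum-+ zero    f g = sym (+-identityˡ 0#)
  sum-+ (suc d) f g = trans (+-congˡ (sum-+ d (λ i → f (suc i)) (λ i → g (suc i))))
                            (+-interchange (f zero) (g zero) _ _)

  sum-*ˡ : ∀ d a (f : Fin d → Carrier) → a * sumᶠ d f ≈ sumᶠ d (λ i → a * f i)
  sum-*ˡ zero    a f = zeroʳ a
  sum-*ˡ (suc d) a f = trans (distribˡ a (f zero) _) (+-congˡ (sum-*ˡ d a (λ i → f (suc i))))

  sum-*ʳ : ∀ d (f : Fin d → Carrier) a → sumᶠ d f * a ≈ sumᶠ d (λ i → f i * a)
  sum-*ʳ d f a = trans (*-comm _ a) (trans (sum-*ˡ d a f) (sum-cong d (λ i → *-comm a (f i))))

  sum-neg : ∀ d (f : Fin d → Carrier) → - sumᶠ d f ≈ sumᶠ d (λ i → - f i)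
  sum-neg zero    f = -0#≈0#
  sum-neg (suc d) f = trans (sym (-‿+-comm (f zero) _)) (+-congˡ (sum-neg d (λ i → f (suc i))))

  sum-swap : ∀ d m (f : Fin d → Fin m → Carrier) →
    sumᶠ d (λ i → sumᶠ m (λ j → f i j)) ≈ sumᶠ m (λ j → sumᶠ d (λ i → f i j))
  sum-swap zero    m f = sym (sum-0 m (λ _ → refl))
  sum-swap (suc d) m f = trans (+-congˡ (sum-swap d m (λ i → f (suc i))))
                               (sym (sum-+ m (λ j → f zero j) (λ j → sumᶠ d (λ i → f (suc i) j))))

  sum-++ : ∀ a b (f : Fin a → Carrier) (g : Fin b → Carrier) →
           sumᶠ (a ℕ.+ b) (f ++ g) ≈ sumᶠ a f + sumᶠ b g
  sum-++ zero    b f g = sym (+-identityˡ _)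
  sum-++ (suc a) b f g = begin
    f zero + sumᶠ (a ℕ.+ b) (λ i → (f ++ g) (suc i))
      ≈⟨ +-congˡ (sum-cong (a ℕ.+ b) (λ i → reflexive (++-suc f g i))) ⟩
    f zero + sumᶠ (a ℕ.+ b) ((λ k → f (suc k)) ++ g)
      ≈⟨ +-congˡ (sum-++ a b (λ k → f (suc k)) g) ⟩
    f zero + (sumᶠ a (λ k → f (suc k)) + sumᶠ b g)  ≈⟨ +-assoc _ _ _ ⟨
    sumᶠ (suc a) f + sumᶠ b g  ∎

  sum-punch : ∀ d (i : Fin (suc d)) (f : Fin (suc d) → Carrier) →
              sumᶠ (suc d) f ≈ f i + sumᶠ d (λ j → f (punchIn i j))
  sum-punch d       zero    f = refl
  sum-punch (suc d) (suc i) f = begin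
    f zero + sumᶠ (suc d) (λ j → f (suc j))
      ≈⟨ +-congˡ (sum-punch d i (λ j → f (suc j))) ⟩
    f zero + (f (suc i) + rest)  ≈⟨ +-assoc _ _ _ ⟨
    (f zero + f (suc i)) + rest  ≈⟨ +-congʳ (+-comm _ _) ⟩
    (f (suc i) + f zero) + rest  ≈⟨ +-assoc _ _ _ ⟩
    f (suc i) + (f zero + rest)  ∎
    where rest = sumᶠ d (λ j → f (suc (punchIn i j)))

module LinearAlgebra {q n : ℕ} (E : FiniteFieldExt q n) where
  open FiniteFieldExt E using (R; F; F-0; F-1; F-+; F-neg; F-*; F-inv; enum; enum-F;
    enum-inj; enum-surj; basis; basis-indep; basis-span; 1≉0; inv)
  open CommutativeRing R hiding (zero)
  open import Algebra.Properties.Ring ring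
    using (-‿distribˡ-*; -‿distribʳ-*; -1*x≈-x; +-inverseˡ-unique; x∙y⁻¹≈ε⇒x≈y; x≈y⇒x∙y⁻¹≈ε)
  open import Relation.Binary.Reasoning.Setoid setoid
  open Sums R
  open SumProperties R

  -- Section 2.  Decidable equality and exhaustive search.

  dec-F-≈0 : ∀ x → F x → Dec (x ≈ 0#)
  dec-F-≈0 x Fx with enum-surj x Fx | enum-surj 0# F-0
  ... | i , x≈eᵢ | j , 0≈eⱼ with i Finₚ.≟ j
  ...   | yes ≡.refl = yes (trans x≈eᵢ (sym 0≈eⱼ))
  ...   | no i≢j = no (λ x≈0 → i≢j (enum-inj i j (trans (sym x≈eᵢ) (trans x≈0 0≈eⱼ))))

  -- In 𝔽_{q^n}, x ≈ 0 iff all its coordinates over the 𝔽_q-basis vanish.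
  dec-≈0 : ∀ x → Dec (x ≈ 0#)
  dec-≈0 x with basis-span x
  ... | c , Fc , x≈ with Finₚ.all? (λ i → dec-F-≈0 (c i) (Fc i))
  ...   | yes c≈0 = yes (trans x≈ (sum-0 n (λ i → trans (*-congʳ (c≈0 i)) (zeroˡ _))))
  ...   | no c≉0 = no (λ x≈0 → c≉0 (basis-indep c Fc (trans (sym x≈) x≈0)))

  _≈?_ : ∀ x y → Dec (x ≈ y)
  x ≈? y with dec-≈0 (x - y)
  ... | yes x-y≈0 = yes (x∙y⁻¹≈ε⇒x≈y x y x-y≈0)
  ... | no x-y≉0 = no (λ x≈y → x-y≉0 (x≈y⇒x∙y⁻¹≈ε x≈y))

  Searchable : (Carrier → Set) → Set₁
  Searchable S = ∀ (P : Carrier → Set) → (∀ {x y} → x ≈ y → P x → P y) →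
                 (∀ x → Dec (P x)) → Dec (∃ λ x → S x × P x)

  search-tuples : ∀ {S} → Searchable S → ∀ m (P : (Fin m → Carrier) → Set) →
                  (∀ {c c'} → (∀ i → c i ≈ c' i) → P c → P c') →
                  (∀ c → Dec (P c)) → Dec (∃ λ c → (∀ i → S (c i)) × P c)
  search-tuples search zero P resp P? with P? (λ ())
  ... | yes p = yes ((λ ()) , (λ ()) , p)
  ... | no ¬p = no (λ { (c , _ , pc) → ¬p (resp (λ ()) pc) })
  search-tuples {S} search (suc m) P resp P? with search P-head resp-head P-head?
    where
    P-head : Carrier → Set
    P-head a = ∃ λ c → (∀ i → S (c i)) × P (a ∷ c)
    resp-head : ∀ {x y} → x ≈ y → P-head x → P-head y
    resp-head x≈y (c , sc , p) = c , sc , resp (λ { zero → x≈y ; (suc i) → refl }) p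
    P-head? : ∀ a → Dec (P-head a)
    P-head? a = search-tuples search m (λ c → P (a ∷ c))
                  (λ eq → resp (λ { zero → refl ; (suc i) → eq i })) (λ c → P? (a ∷ c))
  ... | yes (a , sa , c , sc , p) = yes ((a ∷ c) , (λ { zero → sa ; (suc i) → sc i }) , p)
  ... | no ¬p = no (λ { (c , sc , pc) → ¬p (c zero , sc zero , (λ i → c (suc i)) ,
                         (λ i → sc (suc i)) , resp (λ { zero → refl ; (suc i) → refl }) pc) })

  -- 𝔽_q is searchable through its enumeration ...
  search-F : Searchable F
  search-F P resp P? with Finₚ.any? (λ i → P? (enum i))
  ... | yes (i , p) = yes (enum i , enum-F i , p)
  ... | no ¬p = no (λ { (x , Fx , px) → let (i , eq) = enum-surj x Fx in ¬p (i , resp eq px) })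

  -- ... and 𝔽_{q^n} through the 𝔽_q-coordinates of its elements.
  search-K : Searchable (All E)
  search-K P resp P?
    with search-tuples search-F n (λ c → P (sumᶠ n (λ i → c i * basis i)))
           (λ eq → resp (sum-cong n (λ i → *-congʳ (eq i)))) (λ c → P? _)
  ... | yes (c , _ , p) = yes (_ , tt , p)
  ... | no ¬p = no (λ { (x , _ , px) → let (c , Fc , eq) = basis-span x in ¬p (c , Fc , resp eq px) })

  record Subfield : Set₁ where
    field
      S        : Carrier → Set
      S-0      : S 0#
      S-1      : S 1#
      S-+      : ∀ x y → S x → S y → S (x + y)
      S-neg    : ∀ x → S x → S (- x)
      S-*      : ∀ x y → S x → S y → S (x * y)
      S-inv    : ∀ x → S x → ¬ (x ≈ 0#) → ∃ λ y → S y × (x * y ≈ 1#)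
      S-search : Searchable S

  𝔽q : Subfield
  𝔽q = record { S = F ; S-0 = F-0 ; S-1 = F-1 ; S-+ = F-+ ; S-neg = F-neg ; S-* = F-*
              ; S-inv = F-inv ; S-search = search-F }

  𝕂 : Subfield
  𝕂 = record { S = All E ; S-0 = tt ; S-1 = tt ; S-+ = λ _ _ _ _ → tt ; S-neg = λ _ _ → tt
             ; S-* = λ _ _ _ _ → tt ; S-inv = λ x _ x≉0 → let (y , xy≈1) = inv x x≉0 in y , tt , xy≈1
             ; S-search = search-K }

  V : ℕ → Set
  V = Vect E

  infix 4 _≐_
  infixl 6 _+ᵥ_
  infixr 7 _·_

  _≐_ : ∀ {r} → V r → V r → Set
  _≐_ = _≋_ E

  _+ᵥ_ : ∀ {r} → V r → V r → V r
  _+ᵥ_ = _+ᵛ_ E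

  _·_ : ∀ {r} → Carrier → V r → V r
  _·_ = _•_ E

  0ᵥ : ∀ {r} → V r
  0ᵥ = 0ᵛ E

  lc : ∀ {r} d → (Fin d → Carrier) → (Fin d → V r) → V r
  lc = lincomb E

  ≐-refl : ∀ {r} {u : V r} → u ≐ u
  ≐-refl j = refl

  ≐-sym : ∀ {r} {u v : V r} → u ≐ v → v ≐ u
  ≐-sym e j = sym (e j)

  ≐-trans : ∀ {r} {u v w : V r} → u ≐ v → v ≐ w → u ≐ w
  ≐-trans e f j = trans (e j) (f j)

  lc-cong : ∀ {r} d {c c' : Fin d → Carrier} {g g' : Fin d → V r} →
            (∀ i → c i ≈ c' i) → (∀ i → g i ≐ g' i) → lc d c g ≐ lc d c' g'
  lc-cong d ec eg j = sum-cong d (λ i → *-cong (ec i) (eg i j))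

  lc-0 : ∀ {r} d {c : Fin d → Carrier} (g : Fin d → V r) → (∀ i → c i ≈ 0#) → lc d c g ≐ 0ᵥ
  lc-0 d g c≈0 j = sum-0 d (λ i → trans (*-congʳ (c≈0 i)) (zeroˡ _))

  lc-0ᵥ : ∀ {r} d (c : Fin d → Carrier) {g : Fin d → V r} → (∀ i → g i ≐ 0ᵥ) → lc d c g ≐ 0ᵥ
  lc-0ᵥ d c g≈0 j = sum-0 d (λ i → trans (*-congˡ (g≈0 i j)) (zeroʳ _))

  lc-+ : ∀ {r} d (c c' : Fin d → Carrier) (g : Fin d → V r) →
         lc d (λ i → c i + c' i) g ≐ lc d c g +ᵥ lc d c' g
  lc-+ d c c' g j = trans (sum-cong d (λ i → distribʳ (g i j) (c i) (c' i))) (sum-+ d _ _)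

  lc-+ᵥ : ∀ {r} d (c : Fin d → Carrier) (g g' : Fin d → V r) →
          lc d c (λ i → g i +ᵥ g' i) ≐ lc d c g +ᵥ lc d c g'
  lc-+ᵥ d c g g' j = trans (sum-cong d (λ i → distribˡ (c i) _ _)) (sum-+ d _ _)

  lc-· : ∀ {r} d a (c : Fin d → Carrier) (g : Fin d → V r) →
         a · lc d c g ≐ lc d (λ i → a * c i) g
  lc-· d a c g j = trans (sum-*ˡ d a _) (sum-cong d (λ i → sym (*-assoc a (c i) (g i j))))

  lc-multiples : ∀ {r} d (c a : Fin d → Carrier) (w : V r) →
                 lc d c (λ i → a i · w) ≐ sumᶠ d (λ i → c i * a i) · w
  lc-multiples d c a w j = trans (sum-cong d (λ i → sym (*-assoc _ _ _))) (sym (sum-*ʳ d _ (w j)))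

  lc-subst : ∀ {r} d s (α : Fin d → Carrier) (β : Fin d → Fin s → Carrier) (p : Fin s → V r) →
    lc d α (λ i → lc s (β i) p) ≐ lc s (λ l → sumᶠ d (λ i → α i * β i l)) p
  lc-subst d s α β p j = begin
    sumᶠ d (λ i → α i * sumᶠ s (λ l → β i l * p l j))
      ≈⟨ sum-cong d (λ i → trans (sum-*ˡ s (α i) _) (sum-cong s (λ l → sym (*-assoc _ _ _)))) ⟩
    sumᶠ d (λ i → sumᶠ s (λ l → (α i * β i l) * p l j))
      ≈⟨ sum-swap d s _ ⟩
    sumᶠ s (λ l → sumᶠ d (λ i → (α i * β i l) * p l j))
      ≈⟨ sum-cong s (λ l → sym (sum-*ʳ d _ (p l j))) ⟩
    sumᶠ s (λ l → sumᶠ d (λ i → α i * β i l) * p l j) ∎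

  lc-++ : ∀ {r} a b (c : Fin a → Carrier) (c' : Fin b → Carrier) (g : Fin a → V r) (g' : Fin b → V r) →
          lc (a ℕ.+ b) (c ++ c') (g ++ g') ≐ lc a c g +ᵥ lc b c' g'
  lc-++ a b c c' g g' j =
    trans (sum-cong (a ℕ.+ b) (λ i → reflexive (++-map₂ (λ x v → x * v j) c c' g g' i)))
          (sum-++ a b _ _)

  lc-halves : ∀ {r} a b (c : Fin (a ℕ.+ b) → Carrier) (g : Fin a → V r) (g' : Fin b → V r) →
              lc (a ℕ.+ b) c (g ++ g') ≐ lc a (λ k → c (k ↑ˡ b)) g +ᵥ lc b (λ k → c (a ↑ʳ k)) g'
  lc-halves a b c g g' = ≐-trans (lc-cong (a ℕ.+ b) (λ i → reflexive (++-halves a b c i)) (λ _ → ≐-refl))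
                                 (lc-++ a b _ _ g g')

  lc-punch : ∀ {r} d (i : Fin (suc d)) (c : Fin (suc d) → Carrier) (g : Fin (suc d) → V r) →
             lc (suc d) c g ≐ c i · g i +ᵥ lc d (λ k → c (punchIn i k)) (λ k → g (punchIn i k))
  lc-punch d i c g j = sum-punch d i (λ k → c k * g k j)

  -- x − y written as x + (−1)·y, the form in which it arises below.
  minus-one-cancel : ∀ {x y} → x ≈ y → x + (- 1#) * y ≈ 0#
  minus-one-cancel {x} {y} x≈y = trans (+-congˡ (-1*x≈-x y)) (x≈y⇒x∙y⁻¹≈ε x≈y)

  add-back : ∀ x y → (x + (- 1#) * y) + y ≈ x
  add-back x y = begin
    (x + (- 1#) * y) + y  ≈⟨ +-assoc _ _ _ ⟩
    x + ((- 1#) * y + y)  ≈⟨ +-congˡ (+-congʳ (-1*x≈-x y)) ⟩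
    x + (- y + y)         ≈⟨ +-congˡ (-‿inverseˡ y) ⟩
    x + 0#                ≈⟨ +-identityʳ x ⟩
    x                     ∎

  halves-≈0 : ∀ a b (c : Fin (a ℕ.+ b) → Carrier) →
              (∀ k → c (k ↑ˡ b) ≈ 0#) → (∀ k → c (a ↑ʳ k) ≈ 0#) → ∀ i → c i ≈ 0#
  halves-≈0 a b c c₁≈0 c₂≈0 i =
    trans (reflexive (++-halves a b c i)) (++-all (_≈ 0#) _ _ c₁≈0 c₂≈0 i)

  δ : ∀ {d} → Fin d → Fin d → Carrier
  δ i k with i Finₚ.≟ k
  ... | yes _ = 1#
  ... | no _ = 0#

  δ-same : ∀ {d} (i : Fin d) → δ i i ≈ 1#
  δ-same i with i Finₚ.≟ i
  ... | yes _ = refl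
  ... | no i≢i = ⊥-elim (i≢i ≡.refl)

  δ-diff : ∀ {d} (i k : Fin d) → ¬ (i ≡ k) → δ i k ≈ 0#
  δ-diff i k i≢k with i Finₚ.≟ k
  ... | yes i≡k = ⊥-elim (i≢k i≡k)
  ... | no _ = refl

  lc-δ : ∀ {r} d (i : Fin d) (g : Fin d → V r) → lc d (δ i) g ≐ g i
  lc-δ (suc d) i g j = begin
    lc (suc d) (δ i) g j ≈⟨ lc-punch d i (δ i) g j ⟩
    δ i i * g i j + lc d (λ k → δ i (punchIn i k)) (λ k → g (punchIn i k)) j
      ≈⟨ +-cong (trans (*-congʳ (δ-same i)) (*-identityˡ _))
                (lc-0 d (λ k → g (punchIn i k))
                  (λ k → δ-diff i (punchIn i k) (λ e → Finₚ.punchInᵢ≢i i k (≡.sym e))) j) ⟩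
    g i j + 0# ≈⟨ +-identityʳ _ ⟩
    g i j ∎

  module Blocks (r₁ r₂ : ℕ) where
    π₁ : V (r₁ ℕ.+ r₂) → V r₁
    π₁ v i = v (i ↑ˡ r₂)

    π₂ : V (r₁ ℕ.+ r₂) → V r₂
    π₂ v j = v (r₁ ↑ʳ j)

    ≐-by-blocks : ∀ {u v : V (r₁ ℕ.+ r₂)} → π₁ u ≐ π₁ v → π₂ u ≐ π₂ v → u ≐ v
    ≐-by-blocks {u} {v} e₁ e₂ i with splitAt r₁ i in eq
    ... | inj₁ x = ≡.subst (λ k → u k ≈ v k) (Finₚ.splitAt⁻¹-↑ˡ eq) (e₁ x)
    ... | inj₂ y = ≡.subst (λ k → u k ≈ v k) (Finₚ.splitAt⁻¹-↑ʳ eq) (e₂ y)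

  -- Section 3.  Linear algebra over a searchable subfield of scalars.
  module Over (𝕊 : Subfield) where
    open Subfield 𝕊

    InSpan : ∀ {r} d → (Fin d → V r) → V r → Set
    InSpan d g v = ∃ λ c → (∀ i → S (c i)) × (v ≐ lc d c g)

    LI : ∀ {r} d → (Fin d → V r) → Set
    LI = LinIndep E S

    S-sum : ∀ d (f : Fin d → Carrier) → (∀ i → S (f i)) → S (sumᶠ d f)
    S-sum zero    f sf = S-0
    S-sum (suc d) f sf = S-+ _ _ (sf zero) (S-sum d (λ i → f (suc i)) (λ i → sf (suc i)))

    S-δ : ∀ {d} (i k : Fin d) → S (δ i k)
    S-δ i k with i Finₚ.≟ k
    ... | yes _ = S-1
    ... | no _ = S-0

    S-++ : ∀ {a b} (c : Fin a → Carrier) (c' : Fin b → Carrier) →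
           (∀ i → S (c i)) → (∀ i → S (c' i)) → ∀ i → S ((c ++ c') i)
    S-++ = ++-all S

    span-resp : ∀ {r d} {g : Fin d → V r} {v w} → v ≐ w → InSpan d g v → InSpan d g w
    span-resp v≐w (c , sc , e) = c , sc , ≐-trans (≐-sym v≐w) e

    span-resp-family : ∀ {r} d {g g' : Fin d → V r} {v} → (∀ i → g i ≐ g' i) →
                       InSpan d g v → InSpan d g' v
    span-resp-family d g≐g' (c , sc , e) = c , sc , ≐-trans e (lc-cong d (λ _ → refl) g≐g')

    span-0 : ∀ {r} d (g : Fin d → V r) → InSpan d g 0ᵥ
    span-0 d g = (λ _ → 0#) , (λ _ → S-0) , ≐-sym (lc-0 d g (λ _ → refl))

    span-+ : ∀ {r d} {g : Fin d → V r} {v w} → InSpan d g v → InSpan d g w → InSpan d g (v +ᵥ w)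
    span-+ {d = d} {g} (c , sc , e) (c' , sc' , e') =
      (λ i → c i + c' i) , (λ i → S-+ _ _ (sc i) (sc' i)) ,
      ≐-trans (λ j → +-cong (e j) (e' j)) (≐-sym (lc-+ d c c' g))

    span-· : ∀ {r d} {g : Fin d → V r} {v} a → S a → InSpan d g v → InSpan d g (a · v)
    span-· {d = d} {g} a sa (c , sc , e) =
      (λ i → a * c i) , (λ i → S-* _ _ sa (sc i)) , ≐-trans (λ j → *-congˡ (e j)) (lc-· d a c g)

    span-member : ∀ {r} d (g : Fin d → V r) i → InSpan d g (g i)
    span-member d g i = δ i , S-δ i , ≐-sym (lc-δ d i g)

    span-lc : ∀ {r} d (g : Fin d → V r) c → (∀ i → S (c i)) → InSpan d g (lc d c g)
    span-lc d g c sc = c , sc , ≐-refl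

    span-trans : ∀ {r} d s (g : Fin d → V r) (p : Fin s → V r) {v} →
                 (∀ i → InSpan s p (g i)) → InSpan d g v → InSpan s p v
    span-trans d s g p g⊆p (c , sc , e) =
      (λ l → sumᶠ d (λ i → c i * proj₁ (g⊆p i) l)) ,
      (λ l → S-sum d _ (λ i → S-* _ _ (sc i) (proj₁ (proj₂ (g⊆p i)) l))) ,
      ≐-trans e (≐-trans (lc-cong d (λ _ → refl) (λ i → proj₂ (proj₂ (g⊆p i))))
                         (lc-subst d s c (λ i → proj₁ (g⊆p i)) p))

    span-∷ : ∀ {r} d (g : Fin d → V r) w {v} → InSpan d g v → InSpan (suc d) (w ∷ g) v
    span-∷ d g w (c , sc , e) = (0# ∷ c) , (λ { zero → S-0 ; (suc i) → sc i }) ,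
                                (λ j → trans (e j) (sym (trans (+-congʳ (zeroˡ (w j))) (+-identityˡ _))))

    span-++ˡ : ∀ {r} a b (g : Fin a → V r) (g' : Fin b → V r) {v} →
               InSpan a g v → InSpan (a ℕ.+ b) (g ++ g') v
    span-++ˡ a b g g' (c , sc , e) =
      (c ++ (λ _ → 0#)) , S-++ c _ sc (λ _ → S-0) ,
      ≐-trans e (≐-sym (≐-trans (lc-++ a b c _ g g')
                         (λ j → trans (+-congˡ (lc-0 b g' (λ _ → refl) j)) (+-identityʳ _))))

    span-++ʳ : ∀ {r} a b (g : Fin a → V r) (g' : Fin b → V r) {v} →
               InSpan b g' v → InSpan (a ℕ.+ b) (g ++ g') v
    span-++ʳ a b g g' (c , sc , e) =
      ((λ _ → 0#) ++ c) , S-++ _ c (λ _ → S-0) sc ,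
      ≐-trans e (≐-sym (≐-trans (lc-++ a b _ c g g')
                         (λ j → trans (+-congʳ (lc-0 a g (λ _ → refl) j)) (+-identityˡ _))))

    dec-span : ∀ {r} d (g : Fin d → V r) v → Dec (InSpan d g v)
    dec-span d g v = search-tuples S-search d (λ c → v ≐ lc d c g)
      (λ c≈c' e → ≐-trans e (lc-cong d c≈c' (λ _ → ≐-refl)))
      (λ c → Finₚ.all? (λ j → v j ≈? lc d c g j))

    LI-resp : ∀ {r} d {g g' : Fin d → V r} → (∀ i → g i ≐ g' i) → LI d g → LI d g'
    LI-resp d g≐g' li c sc e = li c sc (≐-trans (lc-cong d (λ _ → refl) g≐g') e)

    LI-nonzero : ∀ {r} d (g : Fin d → V r) → LI d g → ∀ i → ¬ (g i ≐ 0ᵥ)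
    LI-nonzero d g li i gᵢ≐0 =
      1≉0 (trans (sym (δ-same i)) (li (δ i) (S-δ i) (≐-trans (lc-δ d i g) gᵢ≐0) i))

    LI-drop-first : ∀ {r} d (g : Fin (suc d) → V r) → LI (suc d) g → LI d (λ i → g (suc i))
    LI-drop-first d g li c sc e i =
      li (0# ∷ c) (λ { zero → S-0 ; (suc i) → sc i })
         (λ j → trans (+-congʳ (zeroˡ (g zero j))) (trans (+-identityˡ _) (e j))) (suc i)

    LI-prefix : ∀ {r} a b (g : Fin a → V r) (g' : Fin b → V r) → LI (a ℕ.+ b) (g ++ g') → LI a g
    LI-prefix a b g g' li c sc e k =
      trans (reflexive (≡.sym (lookup-++ˡ c (λ _ → 0#) k)))
        (li (c ++ (λ _ → 0#)) (S-++ c _ sc (λ _ → S-0))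
            (≐-trans (lc-++ a b c _ g g') (λ j → trans (+-cong (e j) (lc-0 b g' (λ _ → refl) j))
                                                       (+-identityˡ 0#)))
            (k ↑ˡ b))

    LI-cons : ∀ {r} d (v : V r) (g : Fin d → V r) → LI d g → ¬ InSpan d g v → LI (suc d) (v ∷ g)
    LI-cons d v g li v∉ c sc e = coeffs-0
      where
      rest : Fin d → Carrier
      rest i = c (suc i)
      c₀≈0 : c zero ≈ 0#
      c₀≈0 with dec-≈0 (c zero)
      ... | yes c₀≈0 = c₀≈0
      ... | no c₀≉0 with S-inv (c zero) (sc zero) c₀≉0
      ...   | y , sy , c₀y≈1 =
        ⊥-elim (v∉ ((λ i → - y * rest i) , (λ i → S-* _ _ (S-neg y sy) (sc (suc i))) , v≐))
        where
        -- from c₀ v + Σ cᵢ gᵢ = 0:  v = Σ (−c₀⁻¹ cᵢ) gᵢ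
        v≐ : v ≐ lc d (λ i → - y * rest i) g
        v≐ j = begin
          v j                      ≈⟨ *-identityˡ _ ⟨
          1# * v j                 ≈⟨ *-congʳ (trans (*-comm y (c zero)) c₀y≈1) ⟨
          (y * c zero) * v j       ≈⟨ *-assoc _ _ _ ⟩
          y * (c zero * v j)       ≈⟨ *-congˡ (+-inverseˡ-unique _ _ (e j)) ⟩
          y * - lc d rest g j      ≈⟨ -‿distribʳ-* _ _ ⟨
          - (y * lc d rest g j)    ≈⟨ -‿distribˡ-* _ _ ⟩
          - y * lc d rest g j      ≈⟨ lc-· d (- y) rest g j ⟩
          lc d (λ i → - y * rest i) g j ∎
      rest≐0 : lc d rest g ≐ 0ᵥ
      rest≐0 j = trans (sym (trans (+-congʳ (trans (*-congʳ c₀≈0) (zeroˡ (v j)))) (+-identityˡ _))) (e j)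
      coeffs-0 : ∀ i → c i ≈ 0#
      coeffs-0 zero    = c₀≈0
      coeffs-0 (suc i) = li rest (λ i → sc (suc i)) rest≐0 i

    S-insertAt : ∀ {d} (c : Fin d → Carrier) i a → (∀ j → S (c j)) → S a → ∀ k → S (insertAt c i a k)
    S-insertAt c zero a sc sa zero = sa
    S-insertAt c zero a sc sa (suc k) = sc k
    S-insertAt {suc d} c (suc i) a sc sa zero = sc zero
    S-insertAt {suc d} c (suc i) a sc sa (suc k) = S-insertAt (λ j → c (suc j)) i a (λ j → sc (suc j)) sa k

    LI-punch : ∀ {r} d (b : Fin (suc d) → V r) → LI (suc d) b → ∀ i a c → S a → (∀ j → S (c j)) →
               a · b i +ᵥ lc d c (λ j → b (punchIn i j)) ≐ 0ᵥ → ∀ j → c j ≈ 0#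
    LI-punch d b li i a c sa sc e j =
      trans (reflexive (≡.sym (insertAt-punchIn c i a j)))
        (li (insertAt c i a) (S-insertAt c i a sc sa)
            (≐-trans (lc-punch d i (insertAt c i a) b)
               (≐-trans (λ _ → +-cong (*-congʳ (reflexive (insertAt-lookup c i a)))
                          (sum-cong d (λ k → *-congʳ (reflexive (insertAt-punchIn c i a k))))) e))
            (punchIn i j))

    span-drop-first : ∀ {r} m (u : Fin (suc m) → V r) (c : Fin (suc m) → Carrier) {v} →
                      (∀ i → S (c i)) → c zero ≈ 0# → v ≐ lc (suc m) c u → InSpan m (λ i → u (suc i)) v
    span-drop-first m u c sc c₀≈0 e = (λ i → c (suc i)) , (λ i → sc (suc i)) ,
      (λ j → trans (e j) (trans (+-congʳ (trans (*-congʳ c₀≈0) (zeroˡ _))) (+-identityˡ _)))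

    cancel-pivot : ∀ a y μ → μ * y ≈ 1# → a + (- (a * y)) * μ ≈ 0#
    cancel-pivot a y μ μy≈1 = begin
      a + (- (a * y)) * μ  ≈⟨ +-congˡ (-‿distribˡ-* _ _) ⟨
      a + - ((a * y) * μ)  ≈⟨ +-congˡ (-‿cong (trans (*-assoc _ _ _) (*-congˡ (trans (*-comm y μ) μy≈1)))) ⟩
      a + - (a * 1#)       ≈⟨ +-congˡ (-‿cong (*-identityʳ a)) ⟩
      a - a                ≈⟨ -‿inverseʳ a ⟩
      0#                   ∎

    -- Exchange step: if u₀ occurs with nonzero coefficient μ in b_{i₀}, then the d
    -- vectors b_j − (μ_j / μ) b_{i₀} (j ≠ i₀) avoid u₀ and are still independent.
    eliminate-pivot : ∀ {r} m (u : Fin (suc m) → V r) d (b : Fin (suc d) → V r) → LI (suc d) b →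
      (sp : ∀ i → InSpan (suc m) u (b i)) (i₀ : Fin (suc d)) → ¬ (proj₁ (sp i₀) zero ≈ 0#) →
      ∃ λ (b' : Fin d → V r) → LI d b' × (∀ j → InSpan m (λ i → u (suc i)) (b' j))
    eliminate-pivot m u d b li sp i₀ μ₀≉0 with S-inv _ (proj₁ (proj₂ (sp i₀)) zero) μ₀≉0
    ... | y , sy , μ₀y≈1 = b' , li' , sp'
      where
      -- the coefficient of u₀ in b_{punchIn i₀ j}, divided by the pivot
      ρ : Fin d → Carrier
      ρ j = proj₁ (sp (punchIn i₀ j)) zero * y
      Sρ : ∀ j → S (ρ j)
      Sρ j = S-* _ _ (proj₁ (proj₂ (sp (punchIn i₀ j))) zero) sy
      b' : Fin d → V _
      b' j = b (punchIn i₀ j) +ᵥ (- ρ j) · b i₀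
      sp' : ∀ j → InSpan m (λ i → u (suc i)) (b' j)
      sp' j = span-drop-first m u (proj₁ X) (proj₁ (proj₂ X)) (cancel-pivot _ y _ μ₀y≈1) (proj₂ (proj₂ X))
        where
        X : InSpan (suc m) u (b' j)
        X = span-+ {d = suc m} {g = u} (sp (punchIn i₀ j))
              (span-· {d = suc m} {g = u} (- ρ j) (S-neg _ (Sρ j)) (sp i₀))
      li' : LI d b'
      li' c sc e = LI-punch d b li i₀ (- σ) c (S-neg _ (S-sum d _ (λ j → S-* _ _ (sc j) (Sρ j)))) sc eq
        where
        σ : Carrier
        σ = sumᶠ d (λ j → c j * ρ j)
        eq : (- σ) · b i₀ +ᵥ lc d c (λ j → b (punchIn i₀ j)) ≐ 0ᵥ
        eq t = begin
          (- σ) * b i₀ t + lc d c (λ j → b (punchIn i₀ j)) t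
            ≈⟨ +-comm _ _ ⟩
          lc d c (λ j → b (punchIn i₀ j)) t + (- σ) * b i₀ t
            ≈⟨ +-congˡ (*-congʳ (trans (sum-neg d _) (sum-cong d (λ j → -‿distribʳ-* _ _)))) ⟩
          lc d c (λ j → b (punchIn i₀ j)) t + sumᶠ d (λ j → c j * - ρ j) * b i₀ t
            ≈⟨ +-congˡ (lc-multiples d c (λ j → - ρ j) (b i₀) t) ⟨
          lc d c (λ j → b (punchIn i₀ j)) t + lc d c (λ j → (- ρ j) · b i₀) t
            ≈⟨ lc-+ᵥ d c (λ j → b (punchIn i₀ j)) (λ j → (- ρ j) · b i₀) t ⟨
          lc d c b' t ≈⟨ e t ⟩
          0# ∎

    steinitz : ∀ {r} m (u : Fin m → V r) d (b : Fin d → V r) → LI d b →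
               (∀ i → InSpan m u (b i)) → d ℕ.≤ m
    steinitz m u zero b li sp = ℕ.z≤n
    steinitz zero u (suc d) b li sp = ⊥-elim (LI-nonzero (suc d) b li zero (proj₂ (proj₂ (sp zero))))
    steinitz (suc m) u (suc d) b li sp with Finₚ.any? (λ i → ¬? (dec-≈0 (proj₁ (sp i) zero)))
    ... | yes (i₀ , μ₀≉0) with eliminate-pivot m u d b li sp i₀ μ₀≉0
    ...   | b' , li' , sp' = ℕ.s≤s (steinitz m (λ i → u (suc i)) d b' li' sp')
    steinitz (suc m) u (suc d) b li sp | no no-pivot =
      ℕₚ.m≤n⇒m≤1+n (steinitz m (λ i → u (suc i)) (suc d) b li sp-tail)
      where
      u₀-free : ∀ i → proj₁ (sp i) zero ≈ 0#
      u₀-free i with dec-≈0 (proj₁ (sp i) zero)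
      ... | yes μ≈0 = μ≈0
      ... | no μ≉0 = ⊥-elim (no-pivot (i , μ≉0))
      sp-tail : ∀ i → InSpan m (λ i → u (suc i)) (b i)
      sp-tail i = span-drop-first m u (proj₁ (sp i)) (proj₁ (proj₂ (sp i))) (u₀-free i) (proj₂ (proj₂ (sp i)))

    record Extension {r} (Q : V r → Set) s (p : Fin s → V r) m (u : Fin m → V r) : Set where
      constructor extension
      field
        t      : ℕ
        new    : Fin t → V r
        new-Q  : ∀ i → Q (new i)
        new-li : LI (t ℕ.+ s) (new ++ p)
        covers : ∀ j → InSpan (t ℕ.+ s) (new ++ p) (u j)

    extend : ∀ {r} (Q : V r → Set) s (p : Fin s → V r) → LI s p →
             ∀ m (u : Fin m → V r) → (∀ j → Q (u j)) → Extension Q s p m u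
    extend Q s p li-p zero u Qu = extension 0 (λ ()) (λ ()) li-p (λ ())
    extend Q s p li-p (suc m) u Qu with extend Q s p li-p m (λ j → u (suc j)) (λ j → Qu (suc j))
    ... | extension t e Qe li covers with dec-span (t ℕ.+ s) (e ++ p) (u zero)
    ...   | yes u₀∈ = extension t e Qe li (λ { zero → u₀∈ ; (suc j) → covers j })
    ...   | no u₀∉ = extension (suc t) (u zero ∷ e) (λ { zero → Qu zero ; (suc i) → Qe i })
                       (LI-resp (suc (t ℕ.+ s)) regroup (LI-cons (t ℕ.+ s) (u zero) (e ++ p) li u₀∉))
                       (λ { zero → span-resp-family _ regroup (span-member _ (u zero ∷ (e ++ p)) zero)
                          ; (suc j) → span-resp-family _ regroup (span-∷ _ (e ++ p) (u zero) (covers j)) })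
      where
      regroup : ∀ i → (u zero ∷ (e ++ p)) i ≐ ((u zero ∷ e) ++ p) i
      regroup i j = reflexive (≡.cong (λ x → x j) (∷-++ (u zero) e p i))

    shrink : ∀ {r} (Q : V r → Set) s (p : Fin s → V r) t (e : Fin t → V r) → (∀ i → Q (e i)) →
             LI (t ℕ.+ s) (e ++ p) → ∀ t' → t' ℕ.≤ t →
             Σ (Fin t' → V r) λ e' → (∀ i → Q (e' i)) × LI (t' ℕ.+ s) (e' ++ p)
    shrink Q s p zero e Qe li zero _ = e , Qe , li
    shrink Q s p (suc t) e Qe li t' t'≤ with t' ℕ.≟ suc t
    ... | yes ≡.refl = e , Qe , li
    ... | no t'≢ = shrink Q s p t (λ i → e (suc i)) (λ i → Qe (suc i)) li-tail t' (ℕₚ.≤-pred (ℕₚ.≤∧≢⇒< t'≤ t'≢))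
      where
      li-tail : LI (t ℕ.+ s) ((λ i → e (suc i)) ++ p)
      li-tail = LI-resp (t ℕ.+ s) (λ i j → reflexive (≡.cong (λ x → x j) (++-suc e p i)))
                        (LI-drop-first (t ℕ.+ s) (e ++ p) li)

    record BasisOf {r} m (u : Fin m → V r) : Set where
      field
        t  : ℕ
        σ  : Fin t → Fin m
        li : LI t (λ i → u (σ i))
        sp : ∀ j → InSpan t (λ i → u (σ i)) (u j)

    basis-of : ∀ {r} m (u : Fin m → V r) → BasisOf m u
    basis-of {r} m u = record { t = t ; σ = σ ; li = li-σ ; sp = sp-σ }
      where
      open Extension (extend (λ v → ∃ λ j → v ≡ u j) 0 (λ ()) (λ _ _ _ ()) m u (λ j → j , ≡.refl))
      σ : Fin t → Fin m
      σ i = proj₁ (new-Q i)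
      new≐ : ∀ i → new i ≐ u (σ i)
      new≐ i j = reflexive (≡.cong (λ x → x j) (proj₂ (new-Q i)))
      li-σ : LI t (λ i → u (σ i))
      li-σ = LI-resp t new≐ (LI-prefix t 0 new (λ ()) new-li)
      sp-σ : ∀ j → InSpan t (λ i → u (σ i)) (u j)
      sp-σ j with covers j
      ... | c , sc , e = span-resp-family t new≐
                           ((λ k → c (k ↑ˡ 0)) , (λ k → sc (k ↑ˡ 0)) ,
                            ≐-trans e (≐-trans (lc-halves t 0 c new (λ ())) (λ _ → +-identityʳ _)))

    concat-span : ∀ {r} h ds (fs : ∀ i → Fin (ds i) → V r) i {v} →
                  InSpan (ds i) (fs i) v → InSpan (total h ds) (concat h ds fs) v
    concat-span (suc h) ds fs zero    v∈ = span-++ˡ (ds zero) _ (fs zero) _ v∈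
    concat-span (suc h) ds fs (suc i) v∈ =
      span-++ʳ (ds zero) _ (fs zero) _ (concat-span h (λ i → ds (suc i)) (λ i → fs (suc i)) i v∈)

    subspace-lc : ∀ {r} {X : V r → Set} → Subspace E S X → ∀ d (c : Fin d → Carrier) (g : Fin d → V r) →
                  (∀ i → S (c i)) → (∀ i → X (g i)) → X (lc d c g)
    subspace-lc (_ , X-0 , _ , _) zero c g sc Xg = X-0
    subspace-lc X-sub@(_ , _ , X-+ , X-·) (suc d) c g sc Xg =
      X-+ _ _ (X-· (c zero) (g zero) (sc zero) (Xg zero))
              (subspace-lc X-sub d (λ i → c (suc i)) (λ i → g (suc i)) (λ i → sc (suc i)) (λ i → Xg (suc i)))

    subspace-span : ∀ {r} {X : V r → Set} → Subspace E S X → ∀ d (g : Fin d → V r) {v} →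
                    (∀ i → X (g i)) → InSpan d g v → X v
    subspace-span X-sub d g Xg (c , sc , e) = proj₁ X-sub (≐-sym e) (subspace-lc X-sub d c g sc Xg)

    -- Section 4.  Decomposing a family of V(r₁) ⊕ V(r₂) along the projection π₂.
    module DirectSum (r₁ r₂ : ℕ) where
      open Blocks r₁ r₂

      record Decomposition m (g : Fin m → V (r₁ ℕ.+ r₂)) : Set where
        field
          a t          : ℕ
          low          : Fin a → V (r₁ ℕ.+ r₂)
          high         : Fin t → V (r₁ ℕ.+ r₂)
          low-in       : ∀ i → InSpan m g (low i)
          high-in      : ∀ i → InSpan m g (high i)
          low-ker      : ∀ i → π₂ (low i) ≐ 0ᵥ
          low-li       : LI a (λ i → π₁ (low i))
          high-li      : LI t (λ i → π₂ (high i))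
          ker-covered  : ∀ {v} → InSpan m g v → π₂ v ≐ 0ᵥ → InSpan a (λ i → π₁ (low i)) (π₁ v)
          proj-covered : ∀ {v} → InSpan m g v → InSpan t (λ i → π₂ (high i)) (π₂ v)

      decompose : ∀ m (g : Fin m → V (r₁ ℕ.+ r₂)) → Decomposition m g
      decompose m g = record
        { a = LB.t ; t = HB.t ; low = low ; high = high
        ; low-in = λ i → z-in (LB.σ i) ; high-in = λ i → span-member m g (HB.σ i)
        ; low-ker = λ i → z-ker (LB.σ i) ; low-li = LB.li ; high-li = HB.li
        ; ker-covered = ker-covered ; proj-covered = proj-covered }
        where
        module HB = BasisOf (basis-of m (λ j → π₂ (g j)))
        high : Fin HB.t → V (r₁ ℕ.+ r₂)
        high i = g (HB.σ i)
        μ : Fin m → Fin HB.t → Carrier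
        μ j = proj₁ (HB.sp j)
        -- z j: g j minus a combination of high with the same V₂-part
        z : Fin m → V (r₁ ℕ.+ r₂)
        z j = g j +ᵥ (- 1#) · lc HB.t (μ j) high
        z-ker : ∀ j → π₂ (z j) ≐ 0ᵥ
        z-ker j y = minus-one-cancel (proj₂ (proj₂ (HB.sp j)) y)
        g≐ : ∀ j → g j ≐ z j +ᵥ lc HB.t (μ j) high
        g≐ j i = sym (add-back (g j i) _)
        z-in : ∀ j → InSpan m g (z j)
        z-in j = span-+ (span-member m g j)
                   (span-· (- 1#) (S-neg _ S-1)
                      (span-trans HB.t m high g (λ i → span-member m g (HB.σ i))
                         (span-lc HB.t high (μ j) (proj₁ (proj₂ (HB.sp j))))))
        module LB = BasisOf (basis-of m (λ j → π₁ (z j)))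
        low : Fin LB.t → V (r₁ ℕ.+ r₂)
        low i = z (LB.σ i)
        proj-covered : ∀ {v} → InSpan m g v → InSpan HB.t (λ i → π₂ (high i)) (π₂ v)
        proj-covered (c , sc , e) =
          span-trans m HB.t (λ j → π₂ (g j)) _ HB.sp (c , sc , (λ y → e (r₁ ↑ʳ y)))
        ker-covered : ∀ {v} → InSpan m g v → π₂ v ≐ 0ᵥ → InSpan LB.t (λ i → π₁ (low i)) (π₁ v)
        ker-covered {v} (c , sc , e) v₂≐0 =
          span-trans m LB.t (λ j → π₁ (z j)) _ LB.sp (c , sc , π₁v≐)
          where
          γ : Fin HB.t → Carrier
          γ l = sumᶠ m (λ j → c j * μ j l)
          v≐ : v ≐ lc m c z +ᵥ lc HB.t γ high
          v≐ = ≐-trans e (≐-trans (lc-cong m (λ _ → refl) g≐)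
                 (≐-trans (lc-+ᵥ m c z _) (λ i → +-congˡ (lc-subst m HB.t c μ high i))))
          -- the high part of v vanishes, since π₂ v = 0 and π₂ high is independent
          γ≈0 : ∀ l → γ l ≈ 0#
          γ≈0 = HB.li γ (λ l → S-sum m _ (λ j → S-* _ _ (sc j) (proj₁ (proj₂ (HB.sp j)) l)))
                  (λ y → trans (sym (trans (+-congʳ (lc-0ᵥ m c z-ker y)) (+-identityˡ _)))
                           (trans (sym (v≐ (r₁ ↑ʳ y))) (v₂≐0 y)))
          π₁v≐ : π₁ v ≐ lc m c (λ j → π₁ (z j))
          π₁v≐ x = trans (v≐ (x ↑ˡ r₂))
                     (trans (+-congˡ (lc-0 HB.t high γ≈0 (x ↑ˡ r₂))) (+-identityʳ _))

      module Decomposed {m} {g : Fin m → V (r₁ ℕ.+ r₂)} (D : Decomposition m g) where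
        open Decomposition D

        family : Fin (a ℕ.+ t) → V (r₁ ℕ.+ r₂)
        family = low ++ high

        family-in : ∀ i → InSpan m g (family i)
        family-in = ++-all (InSpan m g) low high low-in high-in

        -- ... which is independent: first the high, then the low coefficients vanish,
        family-li : LI (a ℕ.+ t) family
        family-li c sc e = halves-≈0 a t c α≈0 β≈0
          where
          α : Fin a → Carrier
          α k = c (k ↑ˡ t)
          β : Fin t → Carrier
          β k = c (a ↑ʳ k)
          split : lc a α low +ᵥ lc t β high ≐ 0ᵥ
          split = ≐-trans (≐-sym (lc-halves a t c low high)) e
          β≈0 : ∀ k → β k ≈ 0#
          β≈0 = high-li β (λ k → sc (a ↑ʳ k))
                  (λ y → trans (sym (trans (+-congʳ (lc-0ᵥ a α low-ker y)) (+-identityˡ _))) (split (r₁ ↑ʳ y)))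
          α≈0 : ∀ k → α k ≈ 0#
          α≈0 = low-li α (λ k → sc (k ↑ˡ t))
                  (λ x → trans (sym (trans (+-congˡ (lc-0 t high β≈0 (x ↑ˡ r₂))) (+-identityʳ _))) (split (x ↑ˡ r₂)))

        -- ... and spans ⟨g⟩: split off the high part of v; the rest lies in V₁.
        family-spans : ∀ {v} → InSpan m g v → InSpan (a ℕ.+ t) family v
        family-spans {v} v∈ with proj-covered v∈
        ... | μ , sμ , π₂v≐ = (κ ++ μ) , S-++ κ μ sκ sμ , v≐
          where
          z : V (r₁ ℕ.+ r₂)
          z = v +ᵥ (- 1#) · lc t μ high
          z-ker : π₂ z ≐ 0ᵥ
          z-ker y = minus-one-cancel (π₂v≐ y)
          z-in : InSpan m g z
          z-in = span-+ v∈ (span-· (- 1#) (S-neg _ S-1) (span-trans t m high g high-in (span-lc t high μ sμ)))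
          κ : Fin a → Carrier
          κ = proj₁ (ker-covered z-in z-ker)
          sκ : ∀ i → S (κ i)
          sκ = proj₁ (proj₂ (ker-covered z-in z-ker))
          z≐ : z ≐ lc a κ low
          z≐ = ≐-by-blocks (proj₂ (proj₂ (ker-covered z-in z-ker)))
                 (λ y → trans (z-ker y) (sym (lc-0ᵥ a κ low-ker y)))
          v≐ : v ≐ lc (a ℕ.+ t) (κ ++ μ) family
          v≐ j = trans (sym (add-back (v j) _)) (trans (+-congʳ (z≐ j)) (sym (lc-++ a t κ μ low high j)))

  module K = Over 𝕂
  module Fq = Over 𝔽q

  Fq⇒K-span : ∀ {r} d (g : Fin d → V r) {v} → Fq.InSpan d g v → K.InSpan d g v
  Fq⇒K-span d g (c , _ , e) = c , (λ _ → tt) , e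

  -- Section 5.  The counting lemma for a single evasive subspace.

  complete-within : ∀ {r} (U : V r → Set) h → DimAtLeast E (All E) (Span E U) h →
    ∀ s (p : Fin s → V r) → K.LI s p → s ℕ.≤ h →
    Σ (Fin (h ℕ.∸ s) → V r) λ e → (∀ i → U (e i)) × K.LI (h ℕ.∸ s ℕ.+ s) (e ++ p)
  complete-within {r} U h (bs , bs-span , bs-li) s p p-li s≤h =
    K.shrink U s p t new new-Q new-li (h ℕ.∸ s) h∸s≤t
    where
    -- bᵢ is a combination of the ds i vectors usᵢ of U
    ds : Fin h → ℕ
    ds i = proj₁ (bs-span i)
    us : ∀ i → Fin (ds i) → V r
    us i = proj₁ (proj₂ (proj₂ (bs-span i)))
    bs-in-us : ∀ i → K.InSpan (ds i) (us i) (bs i)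
    bs-in-us i = let (_ , c , _ , _ , e) = bs-span i in c , (λ _ → tt) , e
    us-U : ∀ l → U (concat h ds us l)
    us-U = concat-all U h ds us (λ i → proj₁ (proj₂ (proj₂ (proj₂ (bs-span i)))))
    open K.Extension (K.extend U s p p-li (total h ds) (concat h ds us) us-U)
    h≤t+s : h ℕ.≤ t ℕ.+ s
    h≤t+s = K.steinitz (t ℕ.+ s) (new ++ p) h bs bs-li
              (λ i → K.span-trans _ _ _ (new ++ p) covers (K.concat-span h ds us i (bs-in-us i)))
    h∸s≤t : h ℕ.∸ s ℕ.≤ t
    h∸s≤t = ℕₚ.m≤n+o⇒m∸n≤o h s (≡.subst (h ℕ.≤_) (ℕₚ.+-comm t s) h≤t+s)

  Fq-LI-++ : ∀ {r} d t s (f : Fin d → V r) (e : Fin t → V r) (p : Fin s → V r) →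
    Fq.LI d f → K.LI (t ℕ.+ s) (e ++ p) → (∀ i → K.InSpan s p (f i)) → Fq.LI (d ℕ.+ t) (f ++ e)
  Fq-LI-++ d t s f e p f-li ep-li f-in c sc eq = halves-≈0 d t c α≈0 β≈0
    where
    α : Fin d → Carrier
    α k = c (k ↑ˡ t)
    β : Fin t → Carrier
    β k = c (d ↑ʳ k)
    λs : Fin d → Fin s → Carrier
    λs i = proj₁ (f-in i)
    -- the f-part rewritten over p
    γ : Fin s → Carrier
    γ l = sumᶠ d (λ i → α i * λs i l)
    split : lc d α f +ᵥ lc t β e ≐ 0ᵥ
    split = ≐-trans (≐-sym (lc-halves d t c f e)) eq
    f-part : lc d α f ≐ lc s γ p
    f-part = ≐-trans (lc-cong d (λ _ → refl) (λ i → proj₂ (proj₂ (f-in i)))) (lc-subst d s α λs p)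
    over-ep : lc (t ℕ.+ s) (β ++ γ) (e ++ p) ≐ 0ᵥ
    over-ep j = trans (lc-++ t s β γ e p j) (trans (+-comm _ _) (trans (+-congʳ (sym (f-part j))) (split j)))
    β≈0 : ∀ k → β k ≈ 0#
    β≈0 k = trans (sym (reflexive (lookup-++ˡ β γ k))) (ep-li (β ++ γ) (λ _ → tt) over-ep (k ↑ˡ s))
    α≈0 : ∀ k → α k ≈ 0#
    α≈0 = f-li α (λ k → sc (k ↑ˡ t))
            (λ j → trans (sym (+-identityʳ _)) (trans (+-congˡ (sym (lc-0 t e β≈0 j))) (split j)))

  -- The counting lemma: if U is (h,k)_q-evasive, p is 𝔽_{q^n}-independent of length
  -- s ≤ h, and f is an 𝔽_q-independent family of length d in U ∩ ⟨p⟩, then d + h ≤ k + s.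
  -- (Complete p within U to an h-dimensional W; then f ++ (completion) ⊆ W ∩ U.)
  evasive-count : ∀ {h k r} {U : V r → Set} → Evasive E h k r U →
    ∀ s (p : Fin s → V r) → K.LI s p → s ℕ.≤ h →
    ∀ d (f : Fin d → V r) → Fq.LI d f → (∀ i → U (f i)) → (∀ i → K.InSpan s p (f i)) →
    d ℕ.+ h ℕ.≤ k ℕ.+ s
  evasive-count {h} {k} {r} {U} (_ , U-dim , U-evasive) s p p-li s≤h d f f-li f-U f-in
    with complete-within U h U-dim s p p-li s≤h
  ... | e , e-U , ep-li = Arithmetic.shift-bound d h s k s≤h bound
    where
    h∸s+s≡h : h ℕ.∸ s ℕ.+ s ≡ h
    h∸s+s≡h = ℕₚ.m∸n+n≡m s≤h
    W : V r → Set
    W = K.InSpan (h ℕ.∸ s ℕ.+ s) (e ++ p)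
    W-sub : Subspace E (All E) W
    W-sub = K.span-resp , K.span-0 _ _ , (λ _ _ → K.span-+) , (λ a _ _ → K.span-· a tt)
    W-dim : HasDim E (All E) W h
    W-dim = ≡.subst (HasDim E (All E) W) h∸s+s≡h
              ((e ++ p) , K.span-member _ _ , ep-li , (λ _ x∈W → x∈W))
    in-W∩U : ∀ i → W ((f ++ e) i) × U ((f ++ e) i)
    in-W∩U = ++-all (λ v → W v × U v) f e
               (λ i → K.span-++ʳ _ s e p (f-in i) , f-U i)
               (λ i → K.span-++ˡ _ s e p (K.span-member _ e i) , e-U i)
    bound : d ℕ.+ (h ℕ.∸ s) ℕ.≤ k
    bound = U-evasive W W-sub W-dim _ (f ++ e) in-W∩U (Fq-LI-++ d _ s f e p f-li ep-li f-in)

  -- Section 6.  Direct sums of evasive subspaces.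
  module DirectSumOf {r₁ r₂ : ℕ} (U₁ : V r₁ → Set) (U₂ : V r₂ → Set) where
    open Blocks r₁ r₂

    U : V (r₁ ℕ.+ r₂) → Set
    U = DirectSum E U₁ U₂

    direct-sum-subspace : ∀ {S} → Subspace E S U₁ → Subspace E S U₂ → Subspace E S U
    direct-sum-subspace (resp₁ , 0∈₁ , +∈₁ , ·∈₁) (resp₂ , 0∈₂ , +∈₂ , ·∈₂) =
      (λ u≐v (u₁ , u₂ , u₁∈ , u₂∈ , e) → u₁ , u₂ , u₁∈ , u₂∈ , ≐-trans (≐-sym u≐v) e) ,
      (0ᵥ , 0ᵥ , 0∈₁ , 0∈₂ , ++-all (0# ≈_) {r₁} {r₂} 0ᵥ 0ᵥ (λ _ → refl) (λ _ → refl)) ,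
      (λ { _ _ (u₁ , u₂ , u₁∈ , u₂∈ , e) (v₁ , v₂ , v₁∈ , v₂∈ , e') →
           (u₁ +ᵥ v₁) , (u₂ +ᵥ v₂) , +∈₁ u₁ v₁ u₁∈ v₁∈ , +∈₂ u₂ v₂ u₂∈ v₂∈ ,
           (λ j → trans (+-cong (e j) (e' j)) (reflexive (++-map₂ _+_ u₁ u₂ v₁ v₂ j))) }) ,
      (λ { a _ a∈S (u₁ , u₂ , u₁∈ , u₂∈ , e) →
           (a · u₁) , (a · u₂) , ·∈₁ a u₁ a∈S u₁∈ , ·∈₂ a u₂ a∈S u₂∈ ,
           (λ j → trans (*-congˡ (e j)) (reflexive (++-map (a *_) u₁ u₂ j))) })

    π₁-∈ : (∀ {u v} → u ≐ v → U₁ u → U₁ v) → ∀ {v} → U v → U₁ (π₁ v)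
    π₁-∈ resp (u₁ , _ , u₁∈ , _ , e) = resp (λ x → sym (trans (e (x ↑ˡ r₂)) (reflexive (lookup-++ˡ u₁ _ x)))) u₁∈

    π₂-∈ : (∀ {u v} → u ≐ v → U₂ u → U₂ v) → ∀ {v} → U v → U₂ (π₂ v)
    π₂-∈ resp (u₁ , u₂ , _ , u₂∈ , e) = resp (λ y → sym (trans (e (r₁ ↑ʳ y)) (reflexive (lookup-++ʳ u₁ u₂ y)))) u₂∈

    ι : V r₁ → V (r₁ ℕ.+ r₂)
    ι v = v ++ 0ᵥ

    ι-lc : ∀ d (c : Fin d → Carrier) (u : Fin d → V r₁) {v} → v ≐ lc d c u → ι v ≐ lc d c (λ l → ι (u l))
    ι-lc d c u e j with splitAt r₁ j
    ... | inj₁ x = e x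
    ... | inj₂ y = sym (sum-0 d (λ _ → zeroʳ _))

    -- ⟨U₁ ⊕ U₂⟩ contains ι⟨U₁⟩, so its dimension is at least that of ⟨U₁⟩.
    direct-sum-span-dim : ∀ {h} → U₂ 0ᵥ → DimAtLeast E (All E) (Span E U₁) h → DimAtLeast E (All E) (Span E U) h
    direct-sum-span-dim {h} 0∈₂ (bs , bs-span , bs-li) = (λ i → ι (bs i)) , ι-span , ι-li
      where
      ι-span : ∀ i → Span E U (ι (bs i))
      ι-span i with bs-span i
      ... | d , c , u , u∈ , e = d , c , (λ l → ι (u l)) , (λ l → u l , 0ᵥ , u∈ l , 0∈₂ , (λ _ → refl)) , ι-lc d c u e
      ι-li : K.LI h (λ i → ι (bs i))
      ι-li c sc e = bs-li c sc (λ x → trans (sum-cong h (λ i → *-congˡ (sym (reflexive (lookup-++ˡ (bs i) 0ᵥ x))))) (e (x ↑ˡ r₂)))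

    direct-sum-bound : ∀ {h k₁ k₂} → Evasive E h k₁ r₁ U₁ → Evasive E h k₂ r₂ U₂ →
      ∀ (W : V (r₁ ℕ.+ r₂) → Set) → Subspace E (All E) W → HasDim E (All E) W h →
      DimAtMost E F (λ v → W v × U v) (k₁ ℕ.+ k₂ ℕ.∸ h)
    direct-sum-bound {h} {k₁} {k₂} ev₁@(U₁-sub , _) ev₂@(U₂-sub , _) W W-sub (w , w-W , w-li , w-span) d b b-∈ b-li =
      Arithmetic.combine-bounds d Db.a Db.t DW.a DW.t h k₁ k₂ d≤ bound₁ bound₂ dim-W
      where
      module KD = K.DirectSum r₁ r₂
      module FD = Fq.DirectSum r₁ r₂
      -- decompositions of the basis w of W (over 𝔽_{q^n}) and of b (over 𝔽_q)
      module DW = KD.Decomposition (KD.decompose h w)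
      module DWᶠ = KD.Decomposed (KD.decompose h w)
      module Db = FD.Decomposition (FD.decompose d b)
      module Dbᶠ = FD.Decomposed (FD.decompose d b)
      in-⟨w⟩ : ∀ {v} → Fq.InSpan d b v → K.InSpan h w v
      in-⟨w⟩ v∈ = w-span _ (K.subspace-span W-sub d b (λ j → proj₁ (b-∈ j)) (Fq⇒K-span d b v∈))
      in-U : ∀ {v} → Fq.InSpan d b v → U v
      in-U = Fq.subspace-span (direct-sum-subspace U₁-sub U₂-sub) d b (λ j → proj₂ (b-∈ j))
      dim-W : DW.a ℕ.+ DW.t ℕ.≤ h
      dim-W = K.steinitz h w _ DWᶠ.family DWᶠ.family-li DWᶠ.family-in
      d≤ : d ℕ.≤ Db.a ℕ.+ Db.t
      d≤ = Fq.steinitz _ Dbᶠ.family d b b-li (λ j → Dbᶠ.family-spans (Fq.span-member d b j))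
      -- π₁(⟨b⟩ ∩ V₁) ⊆ U₁ ∩ π₁(⟨w⟩ ∩ V₁)
      bound₁ : Db.a ℕ.+ h ℕ.≤ k₁ ℕ.+ DW.a
      bound₁ = evasive-count ev₁ DW.a (λ i → π₁ (DW.low i)) DW.low-li (ℕₚ.m+n≤o⇒m≤o DW.a dim-W)
                 Db.a (λ i → π₁ (Db.low i)) Db.low-li
                 (λ i → π₁-∈ (proj₁ U₁-sub) (in-U (Db.low-in i)))
                 (λ i → DW.ker-covered (in-⟨w⟩ (Db.low-in i)) (Db.low-ker i))
      -- π₂⟨b⟩ ⊆ U₂ ∩ π₂⟨w⟩
      bound₂ : Db.t ℕ.+ h ℕ.≤ k₂ ℕ.+ DW.t
      bound₂ = evasive-count ev₂ DW.t (λ i → π₂ (DW.high i)) DW.high-li (ℕₚ.m+n≤o⇒n≤o DW.a dim-W)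
                 Db.t (λ i → π₂ (Db.high i)) Db.high-li
                 (λ i → π₂-∈ (proj₁ U₂-sub) (in-U (Db.high-in i)))
                 (λ i → DW.proj-covered (in-⟨w⟩ (Db.high-in i)))

open import Data.Nat using (ℕ; _+_; _∸_; _≤_)

theorem2p9 : ∀ {q n : ℕ} (E : FiniteFieldExt q n) (h k₁ k₂ r₁ r₂ : ℕ)
    (U₁ : Vect E r₁ → Set) (U₂ : Vect E r₂ → Set) →
    1 ≤ h → 1 ≤ k₁ → 1 ≤ k₂ →
    Evasive E h k₁ r₁ U₁ → Evasive E h k₂ r₂ U₂ →
    Evasive E h (k₁ + k₂ ∸ h) (r₁ + r₂) (DirectSum E U₁ U₂)
theorem2p9 E h k₁ k₂ r₁ r₂ U₁ U₂ _ _ _ ev₁@(U₁-sub , U₁-dim , _) ev₂@(U₂-sub , _) =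
  direct-sum-subspace U₁-sub U₂-sub ,
  direct-sum-span-dim (proj₁ (proj₂ U₂-sub)) U₁-dim ,
  direct-sum-bound ev₁ ev₂
  where
  open LinearAlgebra E using (module DirectSumOf)
  open DirectSumOf U₁ U₂
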